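{- For every fixed positive integer $\ell$, the number of indecomposable wide partitions with exactly $\ell$ parts is finite.
   Context: For partitions $\alpha,\beta$ of the same integer, $\alpha\ge\beta$ (dominance) means $\sum_{k\le j}\alpha_k\ge\sum_{k\le j}\beta_k$ for all $j$; $\nu'$ is the conjugate of $\nu$. $\nu$ is a subpartition of $\lambda$ if the multiset of parts of $\nu$ is a submultiset of that of $\lambda$. $\lambda$ is wide if $\nu\ge\nu'$ for every subpartition $\nu$ of $\lambda$. For partitions $\mu,\nu$, $\mu+\nu$ is the partition whose $i$th part is $\mu_i+\nu_i$ (missing parts treated as $0$). A wide partition $\lambda$ is decomposable if there exist (nonempty) wide partitions $\mu,\nu$ with $\lambda=\mu+\nu$, and indecomposable otherwise. -}

module Defs where

open import Data.Nat using (ℕ; zero; suc; _+_; _≤_; _<_; _≤?_; _⊔_)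
open import Data.List using (List; []; _∷_; take; map; filter; length; upTo; foldr; _++_)
open import Data.Nat.ListAction using (sum)
open import Data.List.Relation.Unary.All using (All)
open import Data.List.Relation.Unary.Linked using (Linked)
open import Data.List.Relation.Binary.Permutation.Propositional using (_↭_)
open import Data.Product using (Σ; ∃; ∃-syntax; _×_)
open import Relation.Binary.PropositionalEquality using (_≡_; _≢_)
open import Relation.Nullary using (¬_)

IsPartition : List ℕ → Set
IsPartition ν = All (0 <_) ν × Linked (λ a b → b ≤ a) ν

Dominates : List ℕ → List ℕ → Set
Dominates α β = (sum α ≡ sum β) × (∀ j → sum (take j β) ≤ sum (take j α))

maxPart : List ℕ → ℕ
maxPart = foldr _⊔_ 0

-- Conjugate: ν'_i = #{k : ν_k ≥ i} for i = 1 .. ν_1.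
conj : List ℕ → List ℕ
conj ν = map (λ i → length (filter (λ x → suc i ≤? x) ν)) (upTo (maxPart ν))

-- ν is a subpartition of λ: the multiset of parts of ν is a submultiset of that of λ.
SubMultiset : List ℕ → List ℕ → Set
SubMultiset ν λ' = ∃[ ρ ] ((ν ++ ρ) ↭ λ')

Wide : List ℕ → Set
Wide λ' = IsPartition λ' × (∀ ν → IsPartition ν → SubMultiset ν λ' → Dominates ν (conj ν))

_⊕_ : List ℕ → List ℕ → List ℕ
[] ⊕ ys = ys
(x ∷ xs) ⊕ [] = x ∷ xs
(x ∷ xs) ⊕ (y ∷ ys) = (x + y) ∷ (xs ⊕ ys)

Decomposable : List ℕ → Set
Decomposable λ' = ∃[ μ ] ∃[ ν ] (Wide μ × Wide ν × μ ≢ [] × ν ≢ [] × λ' ≡ μ ⊕ ν)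

Indecomposable : List ℕ → Set
Indecomposable λ' = Wide λ' × ¬ Decomposable λ'

{-# OPTIONS --safe #-}
-- A partition whose first part is at least the square of its length n dominates its conjugate:
-- the parts of the conjugate are at most n, so its first j < n parts sum to at most n².
-- Let λ be wide with n parts and h = n². If the parts split as λ = T ++ R with every part of the
-- nonempty top T exceeding every part of R (and 0) by at least 2h, then λ = μ + (h, …, h) with
-- length T copies of h, where μ lowers the parts of T by h. Both summands are wide: a
-- subpartition of either one has a first part ≥ h, so it dominates its conjugate by the above,
-- or all its parts are < h; in μ such parts cannot come from the lowered top, so they form a
-- subpartition of λ. Hence in an indecomposable λ consecutive parts (and the last part) differ
-- by less than 2h, so every part is at most 2n³, and there are only finitely many such λ.

module Submission where

open import Defs
open import Data.Nat using (ℕ; zero; suc; _+_; _*_; _∸_; _≤_; _<_; _≥_; _≤?_; _<?_; _<ᵇ_; z≤n; s≤s)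
open import Data.Nat.Properties
open import Data.Nat.ListAction using (sum)
open import Data.Bool using (true; false)
open import Data.List
  using (List; []; _∷_; [_]; _++_; length; map; filter; take; replicate; upTo; applyUpTo; cartesianProductWith)
import Data.List.Properties as List
open import Data.List.Relation.Unary.All using (All; []; _∷_)
import Data.List.Relation.Unary.All as All
import Data.List.Relation.Unary.All.Properties as AllP
open import Data.List.Relation.Unary.Any using (here)
open import Data.List.Relation.Unary.Linked using (Linked; []; [-]; _∷_)
import Data.List.Relation.Unary.Linked as Linked
open import Data.List.Relation.Unary.Linked.Properties using (Linked⇒All)
open import Data.List.Relation.Binary.Permutation.Propositional
  using (_↭_; prep; ↭-refl; ↭-sym; ↭-trans; ↭-reflexive)
open import Data.List.Relation.Binary.Permutation.Propositional.Properties
  using (↭-length; filter-↭; ++⁺ʳ; ++-comm; shift; All-resp-↭)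
open import Data.List.Membership.Propositional using (_∈_)
open import Data.List.Membership.Propositional.Properties using (∈-upTo⁺; ∈-cartesianProductWith⁺)
open import Data.Product using (∃-syntax; _×_; _,_; proj₁; proj₂)
open import Data.Sum using (_⊎_; inj₁; inj₂)
open import Data.Empty using (⊥-elim)
open import Function using (_∘_; flip)
open import Relation.Nullary using (yes; no)
open import Relation.Unary using (Pred; Decidable; ∁)
open import Relation.Binary.PropositionalEquality
  using (_≡_; _≗_; refl; sym; trans; cong; cong₂; subst; subst₂; module ≡-Reasoning)
open import Algebra.Properties.CommutativeSemigroup +-commutativeSemigroup using (interchange)

Descending : List ℕ → Set
Descending = Linked _≥_

square-mono-≤ : ∀ {m n} → m ≤ n → m * m ≤ n * n
square-mono-≤ m≤n = *-mono-≤ m≤n m≤n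

parts≤maxPart : ∀ xs → All (_≤ maxPart xs) xs
parts≤maxPart [] = []
parts≤maxPart (x ∷ xs) =
  m≤m⊔n x (maxPart xs) ∷ All.map (λ y≤ → ≤-trans y≤ (m≤n⊔m x (maxPart xs))) (parts≤maxPart xs)

maxPart-lub : ∀ {b xs} → All (_≤ b) xs → maxPart xs ≤ b
maxPart-lub [] = z≤n
maxPart-lub (x≤b ∷ xs≤b) = ⊔-lub x≤b (maxPart-lub xs≤b)

sum-take≤sum : ∀ j xs → sum (take j xs) ≤ sum xs
sum-take≤sum zero xs = z≤n
sum-take≤sum (suc j) [] = z≤n
sum-take≤sum (suc j) (x ∷ xs) = +-monoʳ-≤ x (sum-take≤sum j xs)

sum-take≤* : ∀ j {b xs} → All (_≤ b) xs → sum (take j xs) ≤ j * b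
sum-take≤* zero _ = z≤n
sum-take≤* (suc j) [] = z≤n
sum-take≤* (suc j) (x≤b ∷ xs≤b) = +-mono-≤ x≤b (sum-take≤* j xs≤b)

applyUpTo-cong : ∀ {f g : ℕ → ℕ} → f ≗ g → ∀ n → applyUpTo f n ≡ applyUpTo g n
applyUpTo-cong {f} {g} f≗g n =
  trans (sym (List.map-upTo f n)) (trans (List.map-cong f≗g (upTo n)) (List.map-upTo g n))

sum-applyUpTo-+ : ∀ (f g : ℕ → ℕ) n →
  sum (applyUpTo (λ i → f i + g i) n) ≡ sum (applyUpTo f n) + sum (applyUpTo g n)
sum-applyUpTo-+ f g zero = refl
sum-applyUpTo-+ f g (suc n) =
  trans (cong (f 0 + g 0 +_) (sum-applyUpTo-+ (f ∘ suc) (g ∘ suc) n)) (interchange (f 0) (g 0) _ _)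

-- count> ν i is the (i+1)-th part of conj ν.
count> : List ℕ → ℕ → ℕ
count> ν i = length (filter (λ x → suc i ≤? x) ν)

-- Case splits on i <ᵇ x, the boolean that does (suc i ≤? x) computes to.
count>-∷ : ∀ x ν i → count> (x ∷ ν) i ≡ count> [ x ] i + count> ν i
count>-∷ x ν i with i <ᵇ x
... | true = refl
... | false = refl

count>-suc : ∀ x i → count> [ suc x ] (suc i) ≡ count> [ x ] i
count>-suc x i with i <ᵇ x
... | true = refl
... | false = refl

sum-count>-[_] : ∀ x {M} → x ≤ M → sum (applyUpTo (count> [ x ]) M) ≡ x
sum-count>-[ zero ] {zero} _ = refl
sum-count>-[ zero ] {suc M} _ = sum-count>-[ zero ] {M} z≤n
sum-count>-[ suc x ] {suc M} (s≤s x≤M) =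
  cong suc (trans (cong sum (applyUpTo-cong (count>-suc x) M)) (sum-count>-[ x ] x≤M))

sum-count> : ∀ ν {M} → All (_≤ M) ν → sum (applyUpTo (count> ν) M) ≡ sum ν
sum-count> [] {zero} _ = refl
sum-count> [] {suc M} _ = sum-count> [] {M} []
sum-count> (x ∷ ν) {M} (x≤M ∷ ν≤M) = begin
  sum (applyUpTo (count> (x ∷ ν)) M)
    ≡⟨ cong sum (applyUpTo-cong (count>-∷ x ν) M) ⟩
  sum (applyUpTo (λ i → count> [ x ] i + count> ν i) M)
    ≡⟨ sum-applyUpTo-+ (count> [ x ]) (count> ν) M ⟩
  sum (applyUpTo (count> [ x ]) M) + sum (applyUpTo (count> ν) M)
    ≡⟨ cong₂ _+_ (sum-count>-[ x ] x≤M) (sum-count> ν ν≤M) ⟩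
  x + sum ν ∎
  where open ≡-Reasoning

sum-conj : ∀ ν → sum (conj ν) ≡ sum ν
sum-conj ν = trans (cong sum (List.map-upTo (count> ν) (maxPart ν))) (sum-count> ν (parts≤maxPart ν))

conj-parts≤length : ∀ ν → All (_≤ length ν) (conj ν)
conj-parts≤length ν = AllP.map⁺ (All.universal (λ i → List.length-filter (λ x → suc i ≤? x) ν) _)

dominates-conj-[] : Dominates [] (conj [])
dominates-conj-[] = refl , λ { zero → z≤n ; (suc _) → z≤n }

long-head⇒dominates-conj : ∀ x xs → length (x ∷ xs) * length (x ∷ xs) ≤ x →
  Dominates (x ∷ xs) (conj (x ∷ xs))
long-head⇒dominates-conj x xs n²≤x = sym (sum-conj ν) , prefix
  where
  ν = x ∷ xs
  n = length ν
  open ≤-Reasoning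
  prefix : ∀ j → sum (take j (conj ν)) ≤ sum (take j ν)
  prefix zero = z≤n
  prefix (suc j) with n ≤? suc j
  ... | yes n≤j = begin
    sum (take (suc j) (conj ν)) ≤⟨ sum-take≤sum (suc j) (conj ν) ⟩
    sum (conj ν)                ≡⟨ sum-conj ν ⟩
    sum ν                       ≡⟨ cong sum (List.take-all (suc j) ν n≤j) ⟨
    sum (take (suc j) ν)        ∎
  ... | no n≰j = begin
    sum (take (suc j) (conj ν)) ≤⟨ sum-take≤* (suc j) (conj-parts≤length ν) ⟩
    suc j * n                   ≤⟨ *-monoˡ-≤ n (<⇒≤ (≰⇒> n≰j)) ⟩
    n * n                       ≤⟨ n²≤x ⟩
    x                           ≤⟨ m≤m+n x _ ⟩
    sum (take (suc j) ν)        ∎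

SubMultiset-trans : ∀ {xs ys zs} → SubMultiset xs ys → SubMultiset ys zs → SubMultiset xs zs
SubMultiset-trans {xs} (ρ , xs++ρ↭ys) (σ , ys++σ↭zs) =
  ρ ++ σ , ↭-trans (↭-reflexive (sym (List.++-assoc xs ρ σ))) (↭-trans (++⁺ʳ σ xs++ρ↭ys) ys++σ↭zs)

SubMultiset-length : ∀ {xs ys} → SubMultiset xs ys → length xs ≤ length ys
SubMultiset-length {xs} (_ , xs++ρ↭ys) = subst (length xs ≤_) (↭-length xs++ρ↭ys) (List.length-++-≤ˡ xs)

SubMultiset-All : ∀ {p} {P : Pred ℕ p} {xs ys} → SubMultiset xs ys → All P ys → All P xs
SubMultiset-All {xs = xs} (_ , xs++ρ↭ys) Pys = AllP.++⁻ˡ xs (All-resp-↭ (↭-sym xs++ρ↭ys) Pys)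

SubMultiset-++⁺ˡ : ∀ xs {ν ys} → SubMultiset ν ys → SubMultiset ν (xs ++ ys)
SubMultiset-++⁺ˡ xs {ys = ys} ν⊆ys = SubMultiset-trans ν⊆ys (xs , ++-comm ys xs)

filter-SubMultiset : ∀ {p} {P : Pred ℕ p} (P? : Decidable P) xs → SubMultiset (filter P? xs) xs
filter-SubMultiset P? [] = [] , ↭-refl
filter-SubMultiset P? (x ∷ xs) with filter-SubMultiset P? xs | P? x
... | ρ , p | yes _ = ρ , prep x p
... | ρ , p | no _ = x ∷ ρ , ↭-trans (shift x (filter P? xs) ρ) (prep x p)

SubMultiset-++⁻ʳ : ∀ {p} {P : Pred ℕ p} (P? : Decidable P) {ν xs ys} →
  All P ν → All (∁ P) xs → SubMultiset ν (xs ++ ys) → SubMultiset ν ys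
SubMultiset-++⁻ʳ P? {ν} {xs} {ys} Pν ¬Pxs (ρ , ν++ρ↭xs++ys) =
  SubMultiset-trans (filter P? ρ , filtered) (filter-SubMultiset P? ys)
  where
  filtered : ν ++ filter P? ρ ↭ filter P? ys
  filtered = subst₂ _↭_
    (trans (List.filter-++ P? ν ρ) (cong (_++ filter P? ρ) (List.filter-all P? Pν)))
    (trans (List.filter-++ P? xs ys) (cong (_++ filter P? ys) (List.filter-none P? ¬Pxs)))
    (filter-↭ P? ν++ρ↭xs++ys)

replicate-descending : ∀ k {h} → Descending (replicate k h)
replicate-descending zero = []
replicate-descending (suc zero) = [-]
replicate-descending (suc (suc k)) = ≤-refl ∷ replicate-descending (suc k)

wide-replicate : ∀ k {h} → 0 < h → k * k ≤ h → Wide (replicate k h)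
wide-replicate k {h} 0<h k²≤h = (AllP.replicate⁺ k 0<h , replicate-descending k) , dominates
  where
  dominates : ∀ ν → IsPartition ν → SubMultiset ν (replicate k h) → Dominates ν (conj ν)
  dominates [] _ _ = dominates-conj-[]
  dominates (x ∷ xs) _ ν⊆ with SubMultiset-All {P = _≡ h} ν⊆ (AllP.replicate⁺ k refl)
  ... | refl ∷ _ = long-head⇒dominates-conj x xs (≤-trans (square-mono-≤ short) k²≤h)
    where
    short : length (x ∷ xs) ≤ k
    short = subst (length (x ∷ xs) ≤_) (List.length-replicate k) (SubMultiset-length ν⊆)

lower-gap : ∀ {h m} T → All (λ t → m + (h + h) ≤ t) T → All (λ u → m + h ≤ u) (map (_∸ h) T)
lower-gap {h} {m} T gap =
  AllP.map⁺ (All.map (λ {t} g → m+n≤o⇒m≤o∸n (m + h) (subst (_≤ t) (sym (+-assoc m h h)) g)) gap)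

descending-lower : ∀ {h} T {R} → Descending (T ++ R) → All (maxPart R ≤_) (map (_∸ h) T) →
  Descending (map (_∸ h) T ++ R)
descending-lower [] sorted _ = sorted
descending-lower (t ∷ []) {[]} _ _ = [-]
descending-lower (t ∷ []) {r ∷ R} (_ ∷ sorted) (m≤t ∷ []) = ≤-trans (m≤m⊔n r (maxPart R)) m≤t ∷ sorted
descending-lower {h} (t ∷ t′ ∷ T) (t′≤t ∷ sorted) (_ ∷ gap) =
  ∸-monoˡ-≤ h t′≤t ∷ descending-lower {h} (t′ ∷ T) sorted gap

length-map-++ : ∀ (f : ℕ → ℕ) T {R} → length (map f T ++ R) ≡ length (T ++ R)
length-map-++ f [] = refl
length-map-++ f (t ∷ T) = cong suc (length-map-++ f T)

wide-lower : ∀ {h} T R → 0 < h → length (T ++ R) * length (T ++ R) ≤ h →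
  All (λ t → maxPart R + (h + h) ≤ t) T → Wide (T ++ R) → Wide (map (_∸ h) T ++ R)
wide-lower {h} T R 0<h n²≤h gap ((positive , sorted) , dominates) =
  (AllP.++⁺ (All.map (<-≤-trans 0<h) high) (AllP.++⁻ʳ T positive) ,
   descending-lower {h} T sorted (All.map (≤-trans (m≤m+n _ h)) lowGap)) ,
  dominates′
  where
  lowGap : All (λ u → maxPart R + h ≤ u) (map (_∸ h) T)
  lowGap = lower-gap {h} T gap
  high : All (h ≤_) (map (_∸ h) T)
  high = All.map (≤-trans (m≤n+m h (maxPart R))) lowGap
  dominates′ : ∀ ν → IsPartition ν → SubMultiset ν (map (_∸ h) T ++ R) → Dominates ν (conj ν)
  dominates′ [] _ _ = dominates-conj-[]
  dominates′ (x ∷ xs) ν-partition ν⊆ with h ≤? x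
  ... | yes h≤x = long-head⇒dominates-conj x xs (≤-trans (square-mono-≤ short) (≤-trans n²≤h h≤x))
    where
    short : length (x ∷ xs) ≤ length (T ++ R)
    short = subst (length (x ∷ xs) ≤_) (length-map-++ (_∸ h) T) (SubMultiset-length ν⊆)
  ... | no h≰x = dominates (x ∷ xs) ν-partition
                   (SubMultiset-++⁺ˡ T (SubMultiset-++⁻ʳ (_<? h) small (All.map ≤⇒≯ high) ν⊆))
    where
    small : All (_< h) (x ∷ xs)
    small = All.map (λ y≤x → ≤-<-trans y≤x (≰⇒> h≰x))
                    (Linked⇒All (flip ≤-trans) ≤-refl (proj₂ ν-partition))

++-as-⊕-replicate : ∀ {h} T R → All (h ≤_) T → T ++ R ≡ (map (_∸ h) T ++ R) ⊕ replicate (length T) h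
++-as-⊕-replicate [] [] _ = refl
++-as-⊕-replicate [] (r ∷ R) _ = refl
++-as-⊕-replicate (t ∷ T) R (h≤t ∷ h≤T) = cong₂ _∷_ (sym (m∸n+n≡m h≤t)) (++-as-⊕-replicate T R h≤T)

Gap : ℕ → List ℕ → Set
Gap D xs = ∃[ t ] ∃[ T ] ∃[ R ] (xs ≡ (t ∷ T) ++ R × All (λ u → maxPart R + D ≤ u) (t ∷ T))

bounded⊎gap : ∀ D xs → Descending xs → All (_≤ D * length xs) xs ⊎ Gap D xs
bounded⊎gap D [] _ = inj₁ []
bounded⊎gap D (x ∷ xs) sorted with bounded⊎gap D xs (Linked.tail sorted)
... | inj₂ (t , T , R , refl , gap@(t-gap ∷ _)) =
  inj₂ (x , t ∷ T , R , refl , ≤-trans t-gap (Linked.head sorted) ∷ gap)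
... | inj₁ bounded with x ≤? D * suc (length xs)
...   | yes x≤ = inj₁ (x≤ ∷ All.map (λ y≤ → ≤-trans y≤ (*-monoʳ-≤ D (n≤1+n (length xs)))) bounded)
...   | no x≰ = inj₂ (x , [] , xs , refl , x-gap ∷ [])
  where
  open ≤-Reasoning
  x-gap : maxPart xs + D ≤ x
  x-gap = begin
    maxPart xs + D         ≤⟨ +-monoˡ-≤ D (maxPart-lub bounded) ⟩
    D * length xs + D      ≡⟨ +-comm (D * length xs) D ⟩
    D + D * length xs      ≡⟨ *-suc D (length xs) ⟨
    D * suc (length xs)    ≤⟨ <⇒≤ (≰⇒> x≰) ⟩
    x                      ∎

gap⇒decomposable : ∀ {h} xs → 0 < h → length xs * length xs ≤ h →
  Wide xs → Gap (h + h) xs → Decomposable xs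
gap⇒decomposable {h} _ 0<h n²≤h wide (t , T , R , refl , gap) =
  map (_∸ h) (t ∷ T) ++ R , replicate (length (t ∷ T)) h ,
  wide-lower (t ∷ T) R 0<h n²≤h gap wide ,
  wide-replicate (length (t ∷ T)) 0<h (≤-trans (square-mono-≤ (List.length-++-≤ˡ (t ∷ T))) n²≤h) ,
  (λ ()) , (λ ()) ,
  ++-as-⊕-replicate (t ∷ T) R
    (All.map (≤-trans (≤-trans (m≤m+n h h) (m≤n+m (h + h) (maxPart R)))) gap)

partBound : ℕ → ℕ
partBound n = (n * n + n * n) * n

indecomposable⇒bounded : ∀ xs → Indecomposable xs → All (_≤ partBound (length xs)) xs
indecomposable⇒bounded [] _ = []
indecomposable⇒bounded xs@(_ ∷ _) (wide , indecomposable)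
  with bounded⊎gap (length xs * length xs + length xs * length xs) xs (proj₂ (proj₁ wide))
... | inj₁ bounded = bounded
... | inj₂ gap = ⊥-elim (indecomposable (gap⇒decomposable xs (s≤s z≤n) ≤-refl wide gap))

boundedLists : ℕ → ℕ → List (List ℕ)
boundedLists zero B = [ [] ]
boundedLists (suc n) B = cartesianProductWith _∷_ (upTo (suc B)) (boundedLists n B)

∈-boundedLists : ∀ {B xs} → All (_≤ B) xs → xs ∈ boundedLists (length xs) B
∈-boundedLists [] = here refl
∈-boundedLists (x≤B ∷ xs≤B) = ∈-cartesianProductWith⁺ _∷_ (∈-upTo⁺ (s≤s x≤B)) (∈-boundedLists xs≤B)

proposition5 : (ℓ : ℕ) → 1 ≤ ℓ →
    ∃[ L ] (∀ (λ' : List ℕ) → Indecomposable λ' → length λ' ≡ ℓ → λ' ∈ L)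
proposition5 ℓ _ = boundedLists ℓ (partBound ℓ) , λ λ' indecomposable length≡ℓ →
  subst (λ n → λ' ∈ boundedLists n (partBound n)) length≡ℓ
    (∈-boundedLists (indecomposable⇒bounded λ' indecomposable))
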